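{- Let $R$ be a finite set of step clauses and $\Diamond l$ an eventuality ($l$ a literal). There is a loop in $\neg l$ within $R$ if and only if the naive loop-detection algorithm, run on $R$ and $l$, outputs a non-empty set of SNF$_m$ clauses.
   Context: Literals are proposition symbols or their negations. A step clause is a formula $\bigwedge_a k_a\Rightarrow\bigcirc\bigvee_d l_d$ with literals $k_a,l_d$ ($\bigcirc$ = "next"). SNF$_m$ clauses: every step clause is an SNF$_m$ clause, and from SNF$_m$ clauses $A\Rightarrow\bigcirc C$ and $B\Rightarrow\bigcirc D$ one forms the SNF$_m$ clause $(A\wedge B)\Rightarrow\bigcirc(C\wedge D)$ (merging); thus every nonempty subset of $R$ merges into one SNF$_m$ clause whose left side is the conjunction of the left sides and whose right side is $\bigcirc$ of the conjunction of the right sides. A loop in $\neg l$ within $R$ is a non-empty finite set of SNF$_m$ clauses $A_i\Rightarrow\bigcirc B_i$ ($0\le i\le n$), each obtained by merging clauses of $R$, such that for every $i$ both $B_i\Rightarrow\neg l$ and $B_i\Rightarrow\bigvee_{j=0}^nA_j$ are classical propositional tautologies (the $A_i,B_i$ being regarded as propositional formulae). Naive algorithm: (1) let $R^*$ be the set of SNF$_m$ clauses obtained by merging the clauses of each nonempty subset of $R$; (2) delete from $R^*$ every clause $X_i\Rightarrow\bigcirc Y_i$ such that $Y_i\Rightarrow\neg l$ is not a tautology; (3) delete from $R^*$ every clause $X_i\Rightarrow\bigcirc Y_i$ such that $Y_i\Rightarrow\bigvee_j X_j$ is not a tautology, where $X_j$ ranges over the left-hand sides of the clauses currently in $R^*$;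 (4) repeat (3) until no more clauses can be deleted, and output the remaining set. -}

module Defs where

open import Data.Nat using (ℕ; zero; suc)
open import Data.Fin using (Fin; zero; suc)
open import Data.Bool using (Bool; true; false; not; _∧_; _∨_; if_then_else_)
open import Data.Bool.Properties using () renaming (_≟_ to _≟ᵇ_)
open import Data.Vec using (Vec; []; _∷_; lookup)
open import Data.List using (List; []; _∷_; map; foldr; filter; length; concatMap; _++_)
open import Data.List.NonEmpty using (List⁺; _∷_; toList)
open import Data.List.Relation.Unary.All using (All)
open import Data.List.Membership.Propositional using (_∈_)
open import Data.Product using (_×_; _,_)
open import Relation.Binary.PropositionalEquality using (_≡_; refl)
open import Relation.Nullary using (Dec; yes; no; ¬_)
open import Data.Nat using (_≡ᵇ_)

data Literal (n : ℕ) : Set where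
  pos : Fin n → Literal n
  neg : Fin n → Literal n

data Form (n : ℕ) : Set where
  lit  : Literal n → Form n
  ⊤ᶠ ⊥ᶠ : Form n
  _∧ᶠ_ _∨ᶠ_ _⇒ᶠ_ : Form n → Form n → Form n
  ¬ᶠ_  : Form n → Form n

infixr 6 _∧ᶠ_
infixr 5 _∨ᶠ_
infixr 4 _⇒ᶠ_
infix 7 ¬ᶠ_

Valuation : ℕ → Set
Valuation n = Vec Bool n

evalLit : ∀ {n} → Valuation n → Literal n → Bool
evalLit v (pos p) = lookup v p
evalLit v (neg p) = not (lookup v p)

⟦_⟧ : ∀ {n} → Form n → Valuation n → Bool
⟦ lit k ⟧ v = evalLit v k
⟦ ⊤ᶠ ⟧ v = true
⟦ ⊥ᶠ ⟧ v = false
⟦ φ ∧ᶠ ψ ⟧ v = ⟦ φ ⟧ v ∧ ⟦ ψ ⟧ v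
⟦ φ ∨ᶠ ψ ⟧ v = ⟦ φ ⟧ v ∨ ⟦ ψ ⟧ v
⟦ φ ⇒ᶠ ψ ⟧ v = not (⟦ φ ⟧ v) ∨ ⟦ ψ ⟧ v
⟦ ¬ᶠ φ ⟧ v = not (⟦ φ ⟧ v)

Tautology : ∀ {n} → Form n → Set
Tautology {n} φ = (v : Valuation n) → ⟦ φ ⟧ v ≡ true

∀Vec? : ∀ {n} (P : Vec Bool n → Set) → ((v : Vec Bool n) → Dec (P v)) → Dec ((v : Vec Bool n) → P v)
∀Vec? {zero} P d with d []
... | yes p = yes λ { [] → p }
... | no ¬p = no λ f → ¬p (f [])
∀Vec? {suc n} P d with ∀Vec? (λ w → P (true ∷ w)) (λ w → d (true ∷ w))
                     | ∀Vec? (λ w → P (false ∷ w)) (λ w → d (false ∷ w))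
... | yes pt | yes pf = yes λ { (true ∷ w) → pt w ; (false ∷ w) → pf w }
... | no ¬pt | _      = no λ f → ¬pt (λ w → f (true ∷ w))
... | yes _  | no ¬pf = no λ f → ¬pf (λ w → f (false ∷ w))

tautology? : ∀ {n} (φ : Form n) → Dec (Tautology φ)
tautology? φ = ∀Vec? _ (λ v → ⟦ φ ⟧ v ≟ᵇ true)

-- Step clauses  ⋀_a k_a ⇒ ○ ⋁_d l_d

record StepClause (n : ℕ) : Set where
  constructor _⇒○_
  field
    premises   : List (Literal n)
    conclusion : List (Literal n)
open StepClause public

⋀ : ∀ {n} → List (Form n) → Form n
⋀ = foldr _∧ᶠ_ ⊤ᶠ

⋁ : ∀ {n} → List (Form n) → Form n
⋁ = foldr _∨ᶠ_ ⊥ᶠ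

-- An SNF_m clause obtained by merging a nonempty collection of step clauses:
-- left side = conjunction of the left sides, right side = conjunction of the
-- right sides.
SNFm : ℕ → Set
SNFm n = List⁺ (StepClause n)

lhsList : ∀ {n} → List (StepClause n) → Form n
lhsList cs = ⋀ (map (λ c → ⋀ (map lit (premises c))) cs)

rhsList : ∀ {n} → List (StepClause n) → Form n
rhsList cs = ⋀ (map (λ c → ⋁ (map lit (conclusion c))) cs)

lhs : ∀ {n} → SNFm n → Form n
lhs m = lhsList (toList m)

rhs : ∀ {n} → SNFm n → Form n
rhs m = rhsList (toList m)

MergedFrom : ∀ {n} → List (StepClause n) → SNFm n → Set
MergedFrom R m = All (_∈ R) (toList m)


IsLoop : ∀ {n} → List (StepClause n) → Literal n → List⁺ (SNFm n) → Set
IsLoop R l L =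
  All (MergedFrom R) (toList L) ×
  All (λ c → Tautology (rhs c ⇒ᶠ ¬ᶠ lit l) ×
             Tautology (rhs c ⇒ᶠ ⋁ (map lhs (toList L))))
      (toList L)

sublists : ∀ {A : Set} → List A → List (List A)
sublists [] = [] ∷ []
sublists (x ∷ xs) = map (x ∷_) (sublists xs) ++ sublists xs

nonemptySubs : ∀ {A : Set} → List (List A) → List (List⁺ A)
nonemptySubs [] = []
nonemptySubs ([] ∷ xss) = nonemptySubs xss
nonemptySubs ((x ∷ xs) ∷ xss) = (x ∷ xs) ∷ nonemptySubs xss

Rstar : ∀ {n} → List (StepClause n) → List (SNFm n)
Rstar R = nonemptySubs (sublists R)

step2 : ∀ {n} → Literal n → List (SNFm n) → List (SNFm n)
step2 l S = filter (λ c → tautology? (rhs c ⇒ᶠ ¬ᶠ lit l)) S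

step3 : ∀ {n} → List (SNFm n) → List (SNFm n)
step3 S = filter (λ c → tautology? (rhs c ⇒ᶠ ⋁ (map lhs S))) S

-- (4) repeat (3) until nothing is deleted. Each productive round deletes at
-- least one clause, so |S| rounds of fuel always suffice to reach the
-- fixpoint.
iterate3 : ∀ {n} → ℕ → List (SNFm n) → List (SNFm n)
iterate3 zero S = S
iterate3 (suc k) S =
  if length (step3 S) ≡ᵇ length S then S else iterate3 k (step3 S)

naive : ∀ {n} → List (StepClause n) → Literal n → List (SNFm n)
naive R l = let S = step2 l (Rstar R) in iterate3 (length S) S

-- A clause of R* only matters through the set of step clauses it merges: both of its sides
-- are conjunctions over that set. Completeness: every clause of a loop L has a representative
-- in R* merging the same set of step clauses, and steps (2) and (3) never delete a
-- representative, since its right side entails ¬l and the disjunction of the left sides of L,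
-- which entails the disjunction of the left sides of the representatives still present.
-- Soundness: the output consists of merged clauses that passed step (2), and iteration stops
-- only once step (3) deletes nothing (each productive round deletes a clause, so |S| rounds
-- suffice), so the output is itself a loop.
{-# OPTIONS --safe #-}
module Submission where

open import Defs
open import Data.Bool using (true; false; not; _∧_; _∨_)
open import Data.Nat using (ℕ; zero; suc; _≤_; _<_; z≤n; _≡ᵇ_)
open import Data.Nat.Properties using (≡ᵇ⇒≡; ≡⇒≡ᵇ; ≤-refl; ≤-pred; ≤∧≢⇒<; <-≤-trans)
open import Data.List using (List; []; _∷_; map; length)
open import Data.List.NonEmpty using (List⁺; _∷_; toList)
open import Data.List.Properties using (length-filter; filter-complete)
open import Data.List.Relation.Unary.All as All using (All; []; _∷_; uncons)
open import Data.List.Relation.Unary.All.Properties using (all-filter)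
open import Data.List.Relation.Unary.Any using (Any; here; there; toSum)
open import Data.List.Membership.Propositional using (_∈_; find; lose)
open import Data.List.Membership.Propositional.Properties
  using (∈-map⁺; ∈-map⁻; ∈-++⁺ˡ; ∈-++⁺ʳ; ∈-++⁻; ∈-filter⁺; ∈-filter⁻)
open import Data.List.Relation.Binary.Subset.Propositional using (_⊆_)
open import Data.List.Relation.Binary.Subset.Propositional.Properties
  using (⊆-trans; All-resp-⊇; filter-⊆)
open import Data.List.Relation.Binary.Sublist.Propositional
  using ([]; _∷_; _∷ʳ_; minimum; lookup) renaming (_⊆_ to _⊑_)
open import Data.List.Relation.Binary.BagAndSetEquality using (_∼[_]_; set; bag-=⇒; ∷-cong; ↭⇒∼bag)
open import Data.List.Relation.Binary.Permutation.Propositional using (swap; ↭-refl)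
open import Data.Product using (Σ; ∃; _×_; _,_; proj₁; proj₂; uncurry; map₂)
open import Data.Sum using (_⊎_; inj₁; inj₂; [_,_]′)
open import Function using (_∘_; id)
open import Function.Bundles using (_⇔_; mk⇔; Equivalence)
import Function.Properties.Equivalence as ⇔
open import Data.Empty using (⊥-elim)
open import Relation.Nullary using (Dec)
open import Relation.Binary.PropositionalEquality using (_≡_; refl; _≢_; subst)

open Equivalence using (to; from)

module _ {A : Set} where

  ≢[]⇒List⁺ : (P : List A → Set) {xs : List A} → xs ≢ [] → P xs → Σ (List⁺ A) (P ∘ toList)
  ≢[]⇒List⁺ P {[]}     xs≢[] _  = ⊥-elim (xs≢[] refl)
  ≢[]⇒List⁺ P {x ∷ xs} _     Pxs = x ∷ xs , Pxs

  ∈-sublists⁺ : ∀ {xs ys : List A} → ys ⊑ xs → ys ∈ sublists xs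
  ∈-sublists⁺ []         = here refl
  ∈-sublists⁺ (x ∷ʳ σ)   = ∈-++⁺ʳ _ (∈-sublists⁺ σ)
  ∈-sublists⁺ (refl ∷ σ) = ∈-++⁺ˡ (∈-map⁺ _ (∈-sublists⁺ σ))

  ∈-sublists⁻ : ∀ xs {ys : List A} → ys ∈ sublists xs → ys ⊑ xs
  ∈-sublists⁻ [] (here refl) = []
  ∈-sublists⁻ (x ∷ xs) p with ∈-++⁻ (map (x ∷_) (sublists xs)) p
  ... | inj₁ q with zs , zs∈ , refl ← ∈-map⁻ (x ∷_) q = refl ∷ ∈-sublists⁻ xs zs∈
  ... | inj₂ q = x ∷ʳ ∈-sublists⁻ xs q

  ∈-nonemptySubs⁺ : ∀ {x : A} {xs} xss → toList (x ∷ xs) ∈ xss → (x ∷ xs) ∈ nonemptySubs xss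
  ∈-nonemptySubs⁺ ([] ∷ xss)       (there p)   = ∈-nonemptySubs⁺ xss p
  ∈-nonemptySubs⁺ ((y ∷ ys) ∷ xss) (here refl) = here refl
  ∈-nonemptySubs⁺ ((y ∷ ys) ∷ xss) (there p)   = there (∈-nonemptySubs⁺ xss p)

  ∈-nonemptySubs⁻ : ∀ {m : List⁺ A} xss → m ∈ nonemptySubs xss → toList m ∈ xss
  ∈-nonemptySubs⁻ ([] ∷ xss)       p           = there (∈-nonemptySubs⁻ xss p)
  ∈-nonemptySubs⁻ ((y ∷ ys) ∷ xss) (here refl) = here refl
  ∈-nonemptySubs⁻ ((y ∷ ys) ∷ xss) (there p)   = there (∈-nonemptySubs⁻ xss p)

  insert-⊑ : ∀ {x : A} {xs ys} → x ∈ xs → ys ⊑ xs → ∃ λ zs → zs ⊑ xs × zs ∼[ set ] x ∷ ys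
  insert-⊑ (here refl) (_ ∷ʳ σ)   = _ , refl ∷ σ , ⇔.refl
  insert-⊑ (here refl) (refl ∷ σ) =
    _ , refl ∷ σ , mk⇔ there (λ { (here refl) → here refl ; (there p) → p })
  insert-⊑ (there x∈) (y ∷ʳ σ) with zs , τ , zs∼ ← insert-⊑ x∈ σ = zs , y ∷ʳ τ , zs∼
  insert-⊑ {x} (there x∈) (refl ∷ σ) with zs , τ , zs∼ ← insert-⊑ x∈ σ =
    _ , refl ∷ τ , ⇔.trans (∷-cong refl zs∼) (bag-=⇒ (↭⇒∼bag (swap _ x ↭-refl)))

  ⊆⇒∃⊑-∼set : ∀ {xs ys : List A} → All (_∈ xs) ys → ∃ λ zs → zs ⊑ xs × zs ∼[ set ] ys
  ⊆⇒∃⊑-∼set []       = [] , minimum _ , ⇔.refl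
  ⊆⇒∃⊑-∼set (y∈ ∷ ys⊆)
    with zs , σ , zs∼ ← ⊆⇒∃⊑-∼set ys⊆
    with ws , τ , ws∼ ← insert-⊑ y∈ σ = ws , τ , ⇔.trans ws∼ (∷-cong refl zs∼)

∧-true : ∀ {a b} → a ∧ b ≡ true ⇔ (a ≡ true × b ≡ true)
∧-true {true}  = mk⇔ (refl ,_) proj₂
∧-true {false} = mk⇔ (λ ()) (λ { (() , _) })

∨-true : ∀ {a b} → a ∨ b ≡ true ⇔ (a ≡ true ⊎ b ≡ true)
∨-true {true}  = mk⇔ (λ _ → inj₁ refl) (λ _ → refl)
∨-true {false} = mk⇔ inj₂ [ (λ ()) , id ]′

not-∨-true : ∀ {a b} → not a ∨ b ≡ true ⇔ (a ≡ true → b ≡ true)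
not-∨-true {true}  = mk⇔ (λ b _ → b) (λ f → f refl)
not-∨-true {false} = mk⇔ (λ _ ()) (λ _ → refl)

module _ {n : ℕ} where

  infix 4 _⊨_

  _⊨_ : Form n → Form n → Set
  φ ⊨ ψ = ∀ v → ⟦ φ ⟧ v ≡ true → ⟦ ψ ⟧ v ≡ true

  module _ {A : Set} (g : A → Form n) (v : Valuation n) where

    ⋀-true : ∀ xs → ⟦ ⋀ (map g xs) ⟧ v ≡ true ⇔ All (λ x → ⟦ g x ⟧ v ≡ true) xs
    ⋀-true []       = mk⇔ (λ _ → []) (λ _ → refl)
    ⋀-true (x ∷ xs) = mk⇔ (uncurry _∷_ ∘ map₂ (to (⋀-true xs)) ∘ to ∧-true)
                          (from ∧-true ∘ map₂ (from (⋀-true xs)) ∘ uncons)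

    ⋁-true : ∀ xs → ⟦ ⋁ (map g xs) ⟧ v ≡ true ⇔ Any (λ x → ⟦ g x ⟧ v ≡ true) xs
    ⋁-true []       = mk⇔ (λ ()) (λ ())
    ⋁-true (x ∷ xs) = mk⇔ ([ here , there ∘ to (⋁-true xs) ]′ ∘ to ∨-true)
                          (from ∨-true ∘ [ inj₁ , inj₂ ∘ from (⋁-true xs) ]′ ∘ toSum)

  ⋀-map-⊇ : ∀ {A : Set} (g : A → Form n) {xs ys} → ys ⊆ xs → ⋀ (map g xs) ⊨ ⋀ (map g ys)
  ⋀-map-⊇ g ys⊆xs v = from (⋀-true g v _) ∘ All-resp-⊇ ys⊆xs ∘ to (⋀-true g v _)

  lhs-⊇ : ∀ {a b : SNFm n} → toList b ⊆ toList a → lhs a ⊨ lhs b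
  lhs-⊇ = ⋀-map-⊇ (λ c → ⋀ (map lit (premises c)))

  rhs-⊇ : ∀ {a b : SNFm n} → toList b ⊆ toList a → rhs a ⊨ rhs b
  rhs-⊇ = ⋀-map-⊇ (λ c → ⋁ (map lit (conclusion c)))

module _ {n : ℕ} where

  ImpliesNot : Literal n → SNFm n → Set
  ImpliesNot l c = Tautology (rhs c ⇒ᶠ ¬ᶠ lit l)

  Closed : List (SNFm n) → SNFm n → Set
  Closed S c = Tautology (rhs c ⇒ᶠ ⋁ (map lhs S))

  IsLoopList : List (StepClause n) → Literal n → List (SNFm n) → Set
  IsLoopList R l S = All (MergedFrom R) S × All (λ c → ImpliesNot l c × Closed S c) S

  ∈-Rstar⁻ : ∀ {R} {m : SNFm n} → m ∈ Rstar R → MergedFrom R m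
  ∈-Rstar⁻ {R} m∈ = All.tabulate (lookup (∈-sublists⁻ R (∈-nonemptySubs⁻ (sublists R) m∈)))

  iterate3-preserves : (P : List (SNFm n) → Set) → (∀ {S} → P S → P (step3 S)) →
                       ∀ k {S} → P S → P (iterate3 k S)
  iterate3-preserves P step zero    p = p
  iterate3-preserves P step (suc k) {S} p with length (step3 S) ≡ᵇ length S
  ... | true  = p
  ... | false = iterate3-preserves P step k (step p)

  iterate3-⊆ : ∀ k {S} → iterate3 k S ⊆ S
  iterate3-⊆ k = iterate3-preserves (_⊆ _) (λ S⊆ → ⊆-trans (filter-⊆ _ _) S⊆) k id

  step3-fixpoint : ∀ {S} → length (step3 S) ≡ length S → All (Closed S) S
  step3-fixpoint {S} same = subst (All (Closed S)) (filter-complete closed? same) (all-filter closed? S)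
    where
    closed? : ∀ c → Dec (Closed S c)
    closed? c = tautology? (rhs c ⇒ᶠ ⋁ (map lhs S))

  iterate3-fixpoint : ∀ k S → length S ≤ k → All (Closed (iterate3 k S)) (iterate3 k S)
  iterate3-fixpoint zero    [] z≤n = []
  iterate3-fixpoint (suc k) S |S|≤1+k
    with length (step3 S) ≡ᵇ length S
       | ≡ᵇ⇒≡ (length (step3 S)) (length S)
       | ≡⇒≡ᵇ (length (step3 S)) (length S)
  ... | true  | same | _      = step3-fixpoint (same _)
  ... | false | _    | differ = iterate3-fixpoint k (step3 S) (≤-pred (<-≤-trans shrinks |S|≤1+k))
    where
    shrinks : length (step3 S) < length S
    shrinks = ≤∧≢⇒< (length-filter _ S) differ

  naive-isLoopList : ∀ R l → IsLoopList R l (naive R l)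
  naive-isLoopList R l =
    All.tabulate (∈-Rstar⁻ ∘ proj₁ ∘ survives-step2) ,
    All.zip (All.tabulate (proj₂ ∘ survives-step2) , iterate3-fixpoint (length S₀) S₀ ≤-refl)
    where
    S₀ : List (SNFm n)
    S₀ = step2 l (Rstar R)
    survives-step2 : ∀ {c} → c ∈ naive R l → c ∈ Rstar R × ImpliesNot l c
    survives-step2 = ∈-filter⁻ (λ c → tautology? (rhs c ⇒ᶠ ¬ᶠ lit l)) ∘ iterate3-⊆ (length S₀)

  CoveredBy : List (SNFm n) → List (SNFm n) → Set
  CoveredBy L S = ∀ {m} → m ∈ L → ∃ λ m' → m' ∈ S × toList m' ∼[ set ] toList m

  covered-nonempty : ∀ {m L S} → CoveredBy (m ∷ L) S → S ≢ []
  covered-nonempty cov refl with _ , () , _ ← cov (here refl)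

  Rstar-covers : ∀ {R L} → All (MergedFrom R) L → CoveredBy L (Rstar R)
  Rstar-covers {R} merged m∈L with ⊆⇒∃⊑-∼set (All.lookup merged m∈L)
  ... | []     , _ , []∼m with () ← from []∼m (here refl)
  ... | c ∷ cs , σ , c∷cs∼m = c ∷ cs , ∈-nonemptySubs⁺ (sublists R) (∈-sublists⁺ σ) , c∷cs∼m

  ImpliesNot-⊇ : ∀ l {a b : SNFm n} → toList b ⊆ toList a → ImpliesNot l b → ImpliesNot l a
  ImpliesNot-⊇ l b⊆a b⇒¬l v = from not-∨-true (to not-∨-true (b⇒¬l v) ∘ rhs-⊇ b⊆a v)

  step2-covers : ∀ l {L S} → All (ImpliesNot l) L → CoveredBy L S → CoveredBy L (step2 l S)
  step2-covers l impliesNot cov m∈L with m' , m'∈S , m'∼m ← cov m∈L =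
    m' , ∈-filter⁺ (λ c → tautology? (rhs c ⇒ᶠ ¬ᶠ lit l)) m'∈S
           (ImpliesNot-⊇ l (from m'∼m) (All.lookup impliesNot m∈L)) , m'∼m

  ⋁-lhs-covered : ∀ {L S} → CoveredBy L S → ⋁ (map lhs L) ⊨ ⋁ (map lhs S)
  ⋁-lhs-covered {L} {S} cov v sat
    with m , m∈L , lhs-m ← find (to (⋁-true lhs v L) sat)
    with m' , m'∈S , m'∼m ← cov m∈L
    = from (⋁-true lhs v S) (lose m'∈S (lhs-⊇ (to m'∼m) v lhs-m))

  Closed-covered : ∀ {L S} {a b : SNFm n} → CoveredBy L S →
                   toList b ⊆ toList a → Closed L b → Closed S a
  Closed-covered cov b⊆a b-closed v =
    from not-∨-true (⋁-lhs-covered cov v ∘ to not-∨-true (b-closed v) ∘ rhs-⊇ b⊆a v)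

  step3-covers : ∀ {L S} → All (Closed L) L → CoveredBy L S → CoveredBy L (step3 S)
  step3-covers closed cov m∈L with m' , m'∈S , m'∼m ← cov m∈L =
    m' , ∈-filter⁺ _ m'∈S (Closed-covered cov (from m'∼m) (All.lookup closed m∈L)) , m'∼m

  loop⇒naive≢[] : ∀ R l {m L} → IsLoopList R l (m ∷ L) → naive R l ≢ []
  loop⇒naive≢[] R l {m} {L} (merged , conditions) =
    covered-nonempty (iterate3-preserves (CoveredBy (m ∷ L)) (step3-covers closed) (length S₀)
      (step2-covers l impliesNot (Rstar-covers merged)))
    where
    S₀ : List (SNFm n)
    S₀ = step2 l (Rstar R)
    impliesNot : All (ImpliesNot l) (m ∷ L)
    impliesNot = All.map proj₁ conditions
    closed : All (Closed (m ∷ L)) (m ∷ L)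
    closed = All.map proj₂ conditions

theorem8 : (n : ℕ) (R : List (StepClause n)) (l : Literal n) →
    (Σ (List⁺ (SNFm n)) (λ L → IsLoop R l L)) ⇔ (naive R l ≢ [])
theorem8 n R l = mk⇔ (λ { (m ∷ L , isLoop) → loop⇒naive≢[] R l isLoop })
                     (λ naive≢[] → ≢[]⇒List⁺ (IsLoopList R l) naive≢[] (naive-isLoopList R l))
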